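{- Let $\mathcal C$ and $\mathcal D$ be neural codes and suppose that $\mathcal C$ covers $\mathcal D$ in $\mathbf{P}_{\mathbf{Code}}$. Then $\widehat{\mathcal C}$ covers $\widehat{\mathcal D}$ in $\mathbf{P}_{\mathbf{Code}}$.
   Context: A neural code is a set $\mathcal C\subseteq 2^{[n]}$ containing $\varnothing$. For $\sigma\subseteq[n]$, the trunk $\mathrm{Tk}_{\mathcal C}(\sigma)=\{\tau\in\mathcal C:\sigma\subseteq\tau\}$; a trunk is proper if nonempty and not equal to $\mathcal C$. A morphism $f:\mathcal C\to\mathcal D$ is a function such that the preimage of every proper trunk in $\mathcal D$ is a proper trunk in $\mathcal C$; an isomorphism is a bijective morphism whose inverse is a morphism. Write $\mathcal D\le\mathcal C$ if there is a surjective morphism $\mathcal C\to\mathcal D$; this partial order on isomorphism classes is $\mathbf{P}_{\mathbf{Code}}$, and $\mathcal C$ covers $\mathcal D$ if $\mathcal D<\mathcal C$ with no $\mathcal E$ satisfying $\mathcal D<\mathcal E<\mathcal C$. The intersection-completion $\widehat{\mathcal C}$ is the set of all intersections of nonempty subfamilies of $\mathcal C$. -}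

module Defs where

open import Data.Nat using (ℕ)
open import Data.Fin.Subset using (Subset; _⊆_; _∩_) renaming (⊥ to ∅)
open import Data.List using (List; []; _∷_; map; _++_)
open import Data.List.NonEmpty using (List⁺; [_]; _∷⁺_; foldr₁)
open import Data.List.Membership.Propositional using (_∈_)
open import Data.Product using (Σ; ∃; _×_; ∃-syntax)
open import Relation.Nullary using (¬_)
open import Relation.Binary.PropositionalEquality using (_≡_)
open import Function.Bundles using (_⇔_)

-- A code on [n] is a finite list of codewords (subsets of [n]);
-- it is viewed as the set of its members (order/duplicates irrelevant).
Code : ℕ → Set
Code n = List (Subset n)

IsCode : ∀ {n} → Code n → Set
IsCode C = ∅ ∈ C

ProperTrunk : ∀ {n} → Code n → Subset n → Set
ProperTrunk C σ = (∃[ c ] (c ∈ C × σ ⊆ c)) × ¬ (∀ c → c ∈ C → σ ⊆ c)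

-- f (only its values on codewords of C matter) is a morphism C → D:
-- it maps C into D and the preimage of every proper trunk of D is a proper trunk of C.
IsMorphism : ∀ {n m} → Code n → Code m → (Subset n → Subset m) → Set
IsMorphism {n} {m} C D f =
  (∀ c → c ∈ C → f c ∈ D) ×
  (∀ (σ : Subset m) → ProperTrunk D σ →
     ∃[ τ ] (ProperTrunk C τ × (∀ c → c ∈ C → ((σ ⊆ f c) ⇔ (τ ⊆ c)))))

IsSurjOn : ∀ {n m} → Code n → Code m → (Subset n → Subset m) → Set
IsSurjOn C D f = ∀ d → d ∈ D → ∃[ c ] (c ∈ C × f c ≡ d)

Iso : ∀ {n m} → Code n → Code m → Set
Iso C D = ∃[ f ] ∃[ g ] (IsMorphism C D f × IsMorphism D C g ×
            (∀ c → c ∈ C → g (f c) ≡ c) × (∀ d → d ∈ D → f (g d) ≡ d))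

_≼_ : ∀ {m n} → Code m → Code n → Set
D ≼ C = ∃[ f ] (IsMorphism C D f × IsSurjOn C D f)

_≺_ : ∀ {m n} → Code m → Code n → Set
D ≺ C = D ≼ C × ¬ Iso C D

Covers : ∀ {n m} → Code n → Code m → Set
Covers C D = D ≺ C × ¬ (∃[ k ] ∃[ E ] (IsCode {k} E × D ≺ E × E ≺ C))

nonemptySublists : ∀ {A : Set} → List A → List (List⁺ A)
nonemptySublists [] = []
nonemptySublists (x ∷ xs) =
  [ x ] ∷ (map (x ∷⁺_) (nonemptySublists xs) ++ nonemptySublists xs)

⋂ : ∀ {n} → List⁺ (Subset n) → Subset n
⋂ = foldr₁ _∩_

hat : ∀ {n} → Code n → Code n
hat C = map ⋂ (nonemptySublists C)

{-# OPTIONS --safe #-}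

-- The proof tracks rank C, the number of distinct elements of Ĉ, i.e. of closed sets
-- x = ⋂ Tk_C(x). A surjective morphism f : C → D pulls every closed set y of D back to the
-- generator of the trunk f⁻¹(Tk_D y). This is injective, so D ≤ C gives rank D ≤ rank C, and
-- if every closed set of C is pulled back then f is an isomorphism. If rank C ≥ rank D + 2,
-- two closed sets x ⊈ y of C are not pulled back, and c ↦ (x ⊆ c) ∷ f c factors f through a
-- code E with D < E < C: the new coordinate generates a closed set of E that is not pulled
-- back from D, and y is not pulled back from E. Hence a cover raises the rank by exactly one.
-- Finally Ĉ has the same closed sets as C, and h ↦ ⋂ f(Tk_C h) is a surjective morphism
-- Ĉ → D̂, so Ĉ covers D̂.

module Submission where

open import Defs renaming (⋂ to ⋂⁺)
import Data.Bool.Properties as Bool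
open import Data.Nat.Base using (ℕ; suc; _≤_; _<_; s≤s; z≤n; _+_)
open import Data.Nat.Properties
  using (≤-antisym; ≤-trans; ≰⇒>; <⇒≱; +-cancelʳ-≤; _≤?_; module ≤-Reasoning)
open import Data.Fin.Subset
  using (Subset; _⊆_; _∩_; _∪_; ⋂; inside; outside) renaming (⊥ to ∅)
open import Data.Fin.Subset.Properties
  using ( _⊆?_; ⊆-refl; ⊆-trans; ⊆-antisym; ⊆-min; ⊆-max; p∩q⊆p; p∩q⊆q; x∈p∩q⁺
        ; p⊆p∪q; q⊆p∪q; x∈p∪q⁻; ∩-identityʳ; drop-∷-⊆; in⊆in; out⊆-⇔)
open import Data.Vec.Base using (_∷_; tail; here)
open import Data.Vec.Properties using (≡-dec)
open import Data.List.Base using (List; []; _∷_; map; _++_; filter; length; deduplicate)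
open import Data.List.Properties using (length-++; length-map; length-removeAt′)
open import Data.List.NonEmpty using (List⁺; _∷_; toList; _∷⁺_)
open import Data.List.Membership.Propositional using (_∈_; _∉_; find; lose)
open import Data.List.Membership.Propositional.Properties
  using (∈-map⁺; ∈-map⁻; ∈-++⁺ˡ; ∈-++⁺ʳ; ∈-++⁻; ∈-filter⁺; ∈-filter⁻
        ; deduplicate-∈⇔)
open import Data.List.Relation.Unary.Any using (here; there; any?; index; _─_)
import Data.List.Relation.Unary.All as All
open import Data.List.Relation.Unary.Unique.Propositional using (Unique; _∷_)
import Data.List.Relation.Unary.Unique.Propositional.Properties as Unique
import Data.List.Relation.Unary.Unique.DecPropositional.Properties as UniqueDec
open import Data.List.Relation.Binary.Sublist.Propositional using (_∷ʳ_; _∷_; minimum; lookup)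
  renaming (_⊆_ to _⊑_)
open import Data.List.Relation.Binary.Sublist.Propositional.Properties using (filter-⊆)
open import Data.Product using (∃₂; ∃-syntax; _×_; _,_; proj₁; proj₂)
open import Data.Product.Function.NonDependent.Propositional using (_×-⇔_)
open import Data.Sum using (inj₁; inj₂; [_,_]′)
open import Data.Empty using (⊥-elim)
open import Function using (id; _∘_)
open import Function.Bundles using (_⇔_; mk⇔; Equivalence)
open import Function.Construct.Identity using (⇔-id)
open import Function.Construct.Symmetry using (⇔-sym)
open import Function.Properties.Equivalence using () renaming (trans to ⇔-trans)
open import Function.Related.Propositional using (module EquationalReasoning; equivalence)
open import Relation.Nullary using (¬_; Dec; yes; no; does; contradiction)
open import Relation.Nullary.Decidable using (¬?; dec-false)
open import Relation.Unary using (Decidable)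
open import Relation.Binary.Definitions using (DecidableEquality)
open import Relation.Binary.PropositionalEquality
  using (_≡_; _≢_; refl; sym; cong; cong₂; subst)

open Equivalence using (to; from)

_≟ˢ_ : ∀ {n} → DecidableEquality (Subset n)
_≟ˢ_ = ≡-dec Bool._≟_

module _ {A B : Set} (f : A → B) where

  InjectiveOn : List A → Set
  InjectiveOn xs = ∀ {x x′} → x ∈ xs → x′ ∈ xs → f x ≡ f x′ → x ≡ x′

  private
    ∈-─ : ∀ {ys} {y z : B} (z∈ys : z ∈ ys) → y ∈ ys → y ≢ z →
          y ∈ (ys ─ z∈ys)
    ∈-─ (here refl) (here refl) y≢z = contradiction refl y≢z
    ∈-─ (here refl) (there y∈)  _   = y∈
    ∈-─ (there z∈)  (here refl) _   = here refl
    ∈-─ (there z∈)  (there y∈)  y≢z = there (∈-─ z∈ y∈ y≢z)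

  mutual
    length-≤-injection : ∀ {xs ys} → Unique xs → InjectiveOn xs →
                         (∀ {x} → x ∈ xs → f x ∈ ys) → length xs ≤ length ys
    length-≤-injection {[]}     _            _   _    = z≤n
    length-≤-injection {x ∷ xs} (x∉xs ∷ xs!) inj maps =
      length-<-injection xs! (λ p q → inj (there p) (there q)) (maps ∘ there)
        (maps (here refl))
        (λ x′∈xs fx′≡fx → All.lookup x∉xs x′∈xs (sym (inj (there x′∈xs) (here refl) fx′≡fx)))

    length-<-injection : ∀ {xs ys z} → Unique xs → InjectiveOn xs →
                         (∀ {x} → x ∈ xs → f x ∈ ys) →
                         z ∈ ys → (∀ {x} → x ∈ xs → f x ≢ z) → length xs < length ys
    length-<-injection {xs} {ys} xs! inj maps z∈ys missed = begin-strict
      length xs                <⟨ s≤s (length-≤-injection xs! inj maps−z) ⟩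
      suc (length (ys ─ z∈ys)) ≡⟨ length-removeAt′ ys (index z∈ys) ⟨
      length ys                ∎
      where
      open ≤-Reasoning
      maps−z : ∀ {x} → x ∈ xs → f x ∈ (ys ─ z∈ys)
      maps−z x∈ = ∈-─ z∈ys (maps x∈) (missed x∈)

module _ {A : Set} where

  distinct-pair : ∀ {xs : List A} → Unique xs → 2 ≤ length xs →
                  ∃₂ λ x y → x ∈ xs × y ∈ xs × x ≢ y
  distinct-pair {_ ∷ []}    _                   (s≤s ())
  distinct-pair {x ∷ y ∷ _} ((x≢y All.∷ _) ∷ _) _ =
    x , y , here refl , there (here refl) , x≢y

module _ {n : ℕ} where

  ⊆-∩ : {σ p q : Subset n} → σ ⊆ p → σ ⊆ q → σ ⊆ p ∩ q
  ⊆-∩ σ⊆p σ⊆q i∈σ = x∈p∩q⁺ (σ⊆p i∈σ , σ⊆q i∈σ)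

  ∪-⊆⇔ : {p q r : Subset n} → p ∪ q ⊆ r ⇔ (p ⊆ r × q ⊆ r)
  ∪-⊆⇔ {p} {q} {r} = mk⇔ ∪-bounded ∪-least
    where
    ∪-bounded : p ∪ q ⊆ r → p ⊆ r × q ⊆ r
    ∪-bounded p∪q⊆r = ⊆-trans (p⊆p∪q q) p∪q⊆r , ⊆-trans (q⊆p∪q p q) p∪q⊆r
    ∪-least : p ⊆ r × q ⊆ r → p ∪ q ⊆ r
    ∪-least (p⊆r , q⊆r) i∈ = [ p⊆r , q⊆r ]′ (x∈p∪q⁻ p q i∈)

  ⋂-lowerBound : ∀ {ps : List (Subset n)} {p} → p ∈ ps → ⋂ ps ⊆ p
  ⋂-lowerBound {p ∷ ps} (here refl) = p∩q⊆p p (⋂ ps)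
  ⋂-lowerBound {q ∷ ps} (there p∈)  = ⊆-trans (p∩q⊆q q (⋂ ps)) (⋂-lowerBound p∈)

  ⋂-greatest : ∀ {ps : List (Subset n)} {σ} →
               (∀ {p} → p ∈ ps → σ ⊆ p) → σ ⊆ ⋂ ps
  ⋂-greatest {[]}     _  = ⊆-max _
  ⋂-greatest {p ∷ ps} lb = ⊆-∩ (lb (here refl)) (⋂-greatest (lb ∘ there))

  ⋂⁺≡⋂ : (s : List⁺ (Subset n)) → ⋂⁺ s ≡ ⋂ (toList s)
  ⋂⁺≡⋂ (p ∷ ps) = ⋂⁺-∷≡⋂ p ps
    where
    ⋂⁺-∷≡⋂ : ∀ p ps → ⋂⁺ (p ∷ ps) ≡ ⋂ (p ∷ ps)
    ⋂⁺-∷≡⋂ p []       = sym (∩-identityʳ p)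
    ⋂⁺-∷≡⋂ p (q ∷ ps) = cong (p ∩_) (⋂⁺-∷≡⋂ q ps)

module _ {n : ℕ} (C : Code n) where

  NonemptyTrunk : Subset n → Set
  NonemptyTrunk σ = ∃[ c ] (c ∈ C × σ ⊆ c)

  IsTrunkOf : (Subset n → Set) → Subset n → Set
  IsTrunkOf P τ = ∀ c → c ∈ C → P c ⇔ τ ⊆ c

  closure : Subset n → Subset n
  closure σ = ⋂ (filter (σ ⊆?_) C)

  Closed : Subset n → Set
  Closed x = NonemptyTrunk x × closure x ⊆ x

  ⋂-filter-trunk : ∀ {P} (P? : Decidable P) {τ} →
                   IsTrunkOf P τ → IsTrunkOf P (⋂ (filter P? C))
  ⋂-filter-trunk {P} P? {τ} trunk c c∈ = mk⇔ P⇒⋂⊆ ⋂⊆⇒P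
    where
    τ⊆⋂ : τ ⊆ ⋂ (filter P? C)
    τ⊆⋂ = ⋂-greatest λ p∈ → let p∈C , Pp = ∈-filter⁻ P? {xs = C} p∈ in to (trunk _ p∈C) Pp

    P⇒⋂⊆ : P c → ⋂ (filter P? C) ⊆ c
    P⇒⋂⊆ Pc = ⋂-lowerBound (∈-filter⁺ P? c∈ Pc)

    ⋂⊆⇒P : ⋂ (filter P? C) ⊆ c → P c
    ⋂⊆⇒P ⋂⊆c = from (trunk c c∈) (⊆-trans τ⊆⋂ ⋂⊆c)

  closure-trunk : ∀ σ → IsTrunkOf (σ ⊆_) (closure σ)
  closure-trunk σ = ⋂-filter-trunk (σ ⊆?_) λ _ _ → ⇔-id _

  ⋂-Closed : ∀ {ps p} → p ∈ ps → (∀ {q} → q ∈ ps → q ∈ C) → Closed (⋂ ps)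
  ⋂-Closed {ps} p∈ps ps⊆C =
    (_ , ps⊆C p∈ps , ⋂-lowerBound p∈ps) ,
    ⋂-greatest λ q∈ps → to (closure-trunk (⋂ ps) _ (ps⊆C q∈ps)) (⋂-lowerBound q∈ps)

  ⋂-filter-Closed : ∀ {P : Subset n → Set} (P? : Decidable P) →
                    ∃[ c ] (c ∈ C × P c) → Closed (⋂ (filter P? C))
  ⋂-filter-Closed P? (c , c∈ , Pc) =
    ⋂-Closed (∈-filter⁺ P? c∈ Pc) (proj₁ ∘ ∈-filter⁻ P? {xs = C})

  closure-Closed : ∀ {σ} → NonemptyTrunk σ → Closed (closure σ)
  closure-Closed {σ} = ⋂-filter-Closed (σ ⊆?_)

  ∈⇒Closed : ∀ {c} → c ∈ C → Closed c
  ∈⇒Closed c∈ = (_ , c∈ , ⊆-refl) , to (closure-trunk _ _ c∈) ⊆-refl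

  ⊆-closure : ∀ σ → σ ⊆ closure σ
  ⊆-closure σ = ⋂-greatest (proj₂ ∘ ∈-filter⁻ (σ ⊆?_) {xs = C})

  Closed⇒closure≡ : ∀ {x} → Closed x → closure x ≡ x
  Closed⇒closure≡ {x} (_ , closure⊆x) = ⊆-antisym closure⊆x (⊆-closure x)

  Closed-⊆ : ∀ {x y} → Closed x → (∀ c → c ∈ C → x ⊆ c → y ⊆ c) → y ⊆ x
  Closed-⊆ {x} {y} (_ , closure⊆x) Tkx⊆Tky = ⊆-trans (⋂-greatest y⊆) closure⊆x
    where
    y⊆ : ∀ {c} → c ∈ filter (x ⊆?_) C → y ⊆ c
    y⊆ c∈ = let c∈C , x⊆c = ∈-filter⁻ (x ⊆?_) {xs = C} c∈ in Tkx⊆Tky _ c∈C x⊆c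

  Closed-unique : ∀ {x y} → Closed x → Closed y → IsTrunkOf (x ⊆_) y → x ≡ y
  Closed-unique kx ky trunk = ⊆-antisym
    (Closed-⊆ ky λ c c∈ → from (trunk c c∈))
    (Closed-⊆ kx λ c c∈ → to (trunk c c∈))

  ∪-trunk : ∀ {P Q τ τ′} → IsTrunkOf P τ → IsTrunkOf Q τ′ →
            IsTrunkOf (λ c → P c × Q c) (τ ∪ τ′)
  ∪-trunk trunk trunk′ c c∈ = ⇔-trans (trunk c c∈ ×-⇔ trunk′ c c∈) (⇔-sym ∪-⊆⇔)

module _ {A : Set} where

  ∈-nonemptySublists⁺ : ∀ {xs} {s : List⁺ A} → toList s ⊑ xs → s ∈ nonemptySublists xs
  ∈-nonemptySublists⁺ {x ∷ xs} (.x ∷ʳ s⊑xs) =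
    there (∈-++⁺ʳ (map (x ∷⁺_) (nonemptySublists xs)) (∈-nonemptySublists⁺ s⊑xs))
  ∈-nonemptySublists⁺ {x ∷ xs} {_ ∷ []}    (refl ∷ _)    = here refl
  ∈-nonemptySublists⁺ {x ∷ xs} {_ ∷ _ ∷ _} (refl ∷ s⊑xs) =
    there (∈-++⁺ˡ (∈-map⁺ (x ∷⁺_) (∈-nonemptySublists⁺ s⊑xs)))

  ∈-nonemptySublists⁻ : ∀ {xs} {s : List⁺ A} → s ∈ nonemptySublists xs → toList s ⊑ xs
  ∈-nonemptySublists⁻ {x ∷ xs} (here refl) = refl ∷ minimum xs
  ∈-nonemptySublists⁻ {x ∷ xs} (there s∈)
    with ∈-++⁻ (map (x ∷⁺_) (nonemptySublists xs)) s∈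
  ... | inj₂ s∈rest = x ∷ʳ ∈-nonemptySublists⁻ s∈rest
  ... | inj₁ s∈map with ∈-map⁻ (x ∷⁺_) s∈map
  ...   | _ , s′∈ , refl = refl ∷ ∈-nonemptySublists⁻ s′∈

module _ {n : ℕ} {C : Code n} where

  ∈-hat⇒Closed : ∀ {x} → x ∈ hat C → Closed C x
  ∈-hat⇒Closed x∈ with ∈-map⁻ ⋂⁺ x∈
  ... | s , s∈ , refl = subst (Closed C) (sym (⋂⁺≡⋂ s))
          (⋂-Closed C {toList s} (here refl) (lookup (∈-nonemptySublists⁻ s∈)))

  closure∈hat : ∀ {σ} → NonemptyTrunk C σ → closure C σ ∈ hat C
  closure∈hat {σ} (c , c∈ , σ⊆c) with filter (σ ⊆?_) C in eq
  ... | []     = contradiction (subst (c ∈_) eq (∈-filter⁺ (σ ⊆?_) c∈ σ⊆c)) λ ()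
  ... | p ∷ ps = subst (_∈ hat C) (⋂⁺≡⋂ (p ∷ ps)) (∈-map⁺ ⋂⁺ (∈-nonemptySublists⁺ s⊑C))
    where
    s⊑C : p ∷ ps ⊑ C
    s⊑C = subst (_⊑ C) eq (filter-⊆ (σ ⊆?_) C)

  Closed⇒∈-hat : ∀ {x} → Closed C x → x ∈ hat C
  Closed⇒∈-hat kx = subst (_∈ hat C) (Closed⇒closure≡ C kx) (closure∈hat (proj₁ kx))

  ⊆-hat : ∀ {c} → c ∈ C → c ∈ hat C
  ⊆-hat = Closed⇒∈-hat ∘ ∈⇒Closed C

  Closed-hat⇔ : ∀ {x} → Closed (hat C) x ⇔ Closed C x
  Closed-hat⇔ {x} = mk⇔ Closed-hat⇒ Closed-hat⇐
    where
    nonempty⇒ : NonemptyTrunk (hat C) x → NonemptyTrunk C x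
    nonempty⇒ (h , h∈ , x⊆h) with ∈-hat⇒Closed h∈
    ... | (c , c∈ , h⊆c) , _ = c , c∈ , ⊆-trans x⊆h h⊆c

    Closed-hat⇒ : Closed (hat C) x → Closed C x
    Closed-hat⇒ kx = nonempty⇒ (proj₁ kx) ,
      Closed-⊆ (hat C) kx λ h h∈ x⊆h →
        Closed-⊆ C (∈-hat⇒Closed h∈) λ c c∈ h⊆c → to (closure-trunk C x c c∈) (⊆-trans x⊆h h⊆c)

    Closed-hat⇐ : Closed C x → Closed (hat C) x
    Closed-hat⇐ kx@((c , c∈ , x⊆c) , _) = (c , ⊆-hat c∈ , x⊆c) ,
      Closed-⊆ C kx λ c c∈ x⊆c → to (closure-trunk (hat C) x c (⊆-hat c∈)) x⊆c

closedSets : ∀ {n} → Code n → List (Subset n)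
closedSets C = deduplicate _≟ˢ_ (hat C)

rank : ∀ {n} → Code n → ℕ
rank C = length (closedSets C)

module _ {n : ℕ} {C : Code n} where

  ∈-closedSets⇔ : ∀ {x} → x ∈ closedSets C ⇔ Closed C x
  ∈-closedSets⇔ =
    ⇔-trans (⇔-sym (deduplicate-∈⇔ _≟ˢ_)) (mk⇔ ∈-hat⇒Closed Closed⇒∈-hat)

  closedSets! : Unique (closedSets C)
  closedSets! = UniqueDec.deduplicate-! _≟ˢ_ (hat C)

Closed⇒rank≤ : ∀ {n} {C D : Code n} → (∀ {x} → Closed D x → Closed C x) → rank D ≤ rank C
Closed⇒rank≤ D⊆C = length-≤-injection id closedSets! (λ _ _ → id)
  λ x∈ → from ∈-closedSets⇔ (D⊆C (to ∈-closedSets⇔ x∈))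

rank-hat : ∀ {n} (C : Code n) → rank (hat C) ≡ rank C
rank-hat C = ≤-antisym (Closed⇒rank≤ {C = C} (to Closed-hat⇔))
                       (Closed⇒rank≤ {D = C} (from Closed-hat⇔))

module _ {n m : ℕ} {C : Code n} {D : Code m} {f : Subset n → Subset m} where

  surjective-∀ : IsSurjOn C D f → ∀ {P : Subset m → Set} →
                 (∀ c → c ∈ C → P (f c)) → ∀ d → d ∈ D → P d
  surjective-∀ sur Pf d d∈ with sur d d∈
  ... | c , c∈ , refl = Pf c c∈

  preimage-trunk : IsMorphism C D f → ∀ {σ} → NonemptyTrunk D σ →
                   ∃[ τ ] IsTrunkOf C (λ c → σ ⊆ f c) τ
  preimage-trunk (maps , preimage) {σ} ne with All.all? (σ ⊆?_) D
  ... | yes σ⊆D = ∅ , λ c c∈ → mk⇔ (λ _ {_} → ⊆-min c) (λ _ {_} → All.lookup σ⊆D (maps c c∈))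
  ... | no σ⊈D  = let τ , _ , trunk = preimage σ (ne , σ⊈D ∘ λ σ⊆D → All.tabulate (σ⊆D _))
                  in τ , trunk

  trunks⇒IsMorphism : (∀ c → c ∈ C → f c ∈ D) → IsSurjOn C D f →
                      (∀ σ → ProperTrunk D σ → ∃[ τ ] IsTrunkOf C (λ c → σ ⊆ f c) τ) →
                      IsMorphism C D f
  trunks⇒IsMorphism maps sur trunks = maps , preimage
    where
    preimage : ∀ σ → ProperTrunk D σ →
               ∃[ τ ] (ProperTrunk C τ × IsTrunkOf C (λ c → σ ⊆ f c) τ)
    preimage σ pσ@((d , d∈ , σ⊆d) , σ⊈D) with trunks σ pσ | sur d d∈
    ... | τ , trunk | c , c∈ , refl =
      τ , ((c , c∈ , to (trunk c c∈) σ⊆d) ,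
           λ τ⊆C → σ⊈D (surjective-∀ sur λ c′ c′∈ → from (trunk c′ c′∈) (τ⊆C c′ c′∈))) ,
      trunk

  morphism-∅≡∅ : IsCode C → IsCode D → IsMorphism C D f → f ∅ ≡ ∅
  morphism-∅≡∅ ∅∈C ∅∈D (maps , preimage) with f ∅ ⊆? ∅
  ... | yes f∅⊆∅ = ⊆-antisym f∅⊆∅ (⊆-min _)
  ... | no f∅⊈∅
    with preimage (f ∅) ((f ∅ , maps ∅ ∅∈C , ⊆-refl) , λ f∅⊆D → f∅⊈∅ (f∅⊆D ∅ ∅∈D))
  ...   | τ , (_ , τ⊈C) , trunk =
    ⊥-elim (τ⊈C λ c _ → ⊆-trans (to (trunk ∅ ∅∈C) ⊆-refl) (⊆-min c))

module SurjectiveMorphism {n m : ℕ} {C : Code n} {D : Code m} {f : Subset n → Subset m}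
                          (mor : IsMorphism C D f) (sur : IsSurjOn C D f) where

  pull : Subset m → Subset n
  pull y = ⋂ (filter (λ c → y ⊆? f c) C)

  pull-trunk : ∀ {y} → NonemptyTrunk D y → IsTrunkOf C (λ c → y ⊆ f c) (pull y)
  pull-trunk {y} ne = ⋂-filter-trunk C (λ c → y ⊆? f c) (proj₂ (preimage-trunk mor ne))

  pull-Closed : ∀ {y} → NonemptyTrunk D y → Closed C (pull y)
  pull-Closed {y} (d , d∈ , y⊆d) with sur d d∈
  ... | c , c∈ , refl = ⋂-filter-Closed C (λ c → y ⊆? f c) (c , c∈ , y⊆d)

  pull-injective : ∀ {y y′} → Closed D y → Closed D y′ → pull y ≡ pull y′ → y ≡ y′
  pull-injective {y} {y′} ky ky′ eq = Closed-unique D ky ky′ (surjective-∀ sur same-trunk)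
    where
    same-trunk : ∀ c → c ∈ C → (y ⊆ f c) ⇔ (y′ ⊆ f c)
    same-trunk c c∈ = begin
      y ⊆ f c     ∼⟨ pull-trunk (proj₁ ky) c c∈ ⟩
      pull y ⊆ c  ≡⟨ cong (_⊆ c) eq ⟩
      pull y′ ⊆ c ∼⟨ ⇔-sym (pull-trunk (proj₁ ky′) c c∈) ⟩
      y′ ⊆ f c    ∎
      where open EquationalReasoning {k = equivalence}

  image : List (Subset n)
  image = map pull (closedSets D)

  ∈-image? : ∀ x → Dec (x ∈ image)
  ∈-image? x = any? (x ≟ˢ_) image

  ∈-image⁻ : ∀ {x} → x ∈ image →
             ∃[ y ] (Closed D y × IsTrunkOf C (λ c → y ⊆ f c) x)
  ∈-image⁻ x∈ with ∈-map⁻ pull x∈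
  ... | y , y∈ , refl = y , ky , pull-trunk (proj₁ ky)
    where ky = to ∈-closedSets⇔ y∈

  ∈-image⁺ : ∀ {x y} → Closed C x → NonemptyTrunk D y →
             IsTrunkOf C (λ c → y ⊆ f c) x → x ∈ image
  ∈-image⁺ {x} {y} kx ne trunk =
    subst (_∈ image) pull-ȳ≡x (∈-map⁺ pull (from ∈-closedSets⇔ kȳ))
    where
    ȳ = closure D y
    kȳ : Closed D ȳ
    kȳ = closure-Closed D ne
    pull-ȳ≡x : pull ȳ ≡ x
    pull-ȳ≡x = Closed-unique C (pull-Closed (proj₁ kȳ)) kx λ c c∈ → begin
      pull ȳ ⊆ c ∼⟨ ⇔-sym (pull-trunk (proj₁ kȳ) c c∈) ⟩
      ȳ ⊆ f c    ∼⟨ ⇔-sym (closure-trunk D y (f c) (proj₁ mor c c∈)) ⟩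
      y ⊆ f c    ∼⟨ trunk c c∈ ⟩
      x ⊆ c      ∎
      where open EquationalReasoning {k = equivalence}

  private
    pull-maps : ∀ {y} → y ∈ closedSets D → pull y ∈ closedSets C
    pull-maps y∈ = from ∈-closedSets⇔ (pull-Closed (proj₁ (to ∈-closedSets⇔ y∈)))

    pull-injectiveOn : InjectiveOn pull (closedSets D)
    pull-injectiveOn y∈ y′∈ =
      pull-injective (to ∈-closedSets⇔ y∈) (to ∈-closedSets⇔ y′∈)

  rank≤ : rank D ≤ rank C
  rank≤ = length-≤-injection pull closedSets! pull-injectiveOn pull-maps

  rank< : ∀ {x} → Closed C x → x ∉ image → rank D < rank C
  rank< kx x∉ = length-<-injection pull closedSets! pull-injectiveOn pull-maps
    (from ∈-closedSets⇔ kx) λ y∈ pull-y≡x → x∉ (subst (_∈ image) pull-y≡x (∈-map⁺ pull y∈))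

  rank≤⇒∈-image : rank C ≤ rank D → ∀ {x} → Closed C x → x ∈ image
  rank≤⇒∈-image C≤D {x} kx with ∈-image? x
  ... | yes x∈ = x∈
  ... | no x∉  = contradiction C≤D (<⇒≱ (rank< kx x∉))

  section : Subset m → Subset n
  section d with any? (λ c → f c ≟ˢ d) C
  ... | yes ∃c = proj₁ (find ∃c)
  ... | no _   = ∅

  section-∈ : ∀ {d} → d ∈ D → section d ∈ C × f (section d) ≡ d
  section-∈ {d} d∈ with any? (λ c → f c ≟ˢ d) C
  ... | yes ∃c = proj₂ (find ∃c)
  ... | no ∄c  = let c , c∈ , fc≡d = sur d d∈ in contradiction (lose c∈ fc≡d) ∄c

  module _ (C≤D : rank C ≤ rank D) where

    f-reflects-⊆ : ∀ {c c′} → c ∈ C → c′ ∈ C → f c ≡ f c′ → c ⊆ c′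
    f-reflects-⊆ {c} {c′} c∈ c′∈ fc≡fc′
      with ∈-image⁻ (rank≤⇒∈-image C≤D (∈⇒Closed C c∈))
    ... | y , _ , trunk =
      to (trunk c′ c′∈) (subst (y ⊆_) fc≡fc′ (from (trunk c c∈) ⊆-refl))

    section-f : ∀ c → c ∈ C → section (f c) ≡ c
    section-f c c∈ = let c′∈ , fc′≡fc = section-∈ (proj₁ mor c c∈) in
      ⊆-antisym (f-reflects-⊆ c′∈ c∈ fc′≡fc) (f-reflects-⊆ c∈ c′∈ (sym fc′≡fc))

    section-IsMorphism : IsMorphism D C section
    section-IsMorphism = trunks⇒IsMorphism (λ d d∈ → proj₁ (section-∈ d∈))
      (λ c c∈ → f c , proj₁ mor c c∈ , section-f c c∈) trunks
      where
      trunks : ∀ σ → ProperTrunk C σ → ∃[ τ ] IsTrunkOf D (λ d → σ ⊆ section d) τ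
      trunks σ (ne , _) with ∈-image⁻ (rank≤⇒∈-image C≤D (closure-Closed C ne))
      ... | y , _ , trunk = y , λ d d∈ → let c∈ , fc≡d = section-∈ d∈ in begin
        σ ⊆ section d           ∼⟨ closure-trunk C σ _ c∈ ⟩
        closure C σ ⊆ section d ∼⟨ ⇔-sym (trunk _ c∈) ⟩
        y ⊆ f (section d)       ≡⟨ cong (y ⊆_) fc≡d ⟩
        y ⊆ d                   ∎
        where open EquationalReasoning {k = equivalence}

    rank≤⇒Iso : Iso C D
    rank≤⇒Iso =
      f , section , mor , section-IsMorphism , section-f , λ d d∈ → proj₂ (section-∈ d∈)

  ∅∈image : IsCode C → IsCode D → ∅ ∈ image
  ∅∈image ∅∈C ∅∈D = ∈-image⁺ (∈⇒Closed C ∅∈C) (∅ , ∅∈D , ⊆-refl)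
    λ c _ → mk⇔ (λ _ {_} → ⊆-min c) (λ _ {_} → ⊆-min (f c))

  private
    outsideImage? : ∀ x → Dec (x ∉ image)
    outsideImage? = ¬? ∘ ∈-image?

    outsideImage : List (Subset n)
    outsideImage = filter outsideImage? (closedSets C)

    ∈-outsideImage⁻ : ∀ {x} → x ∈ outsideImage → Closed C x × x ∉ image
    ∈-outsideImage⁻ x∈ =
      let x∈C , x∉ = ∈-filter⁻ outsideImage? {xs = closedSets C} x∈ in to ∈-closedSets⇔ x∈C , x∉

    rank≤outsideImage+rank : rank C ≤ length outsideImage + rank D
    rank≤outsideImage+rank = begin
      rank C                             ≤⟨ length-≤-injection id closedSets! (λ _ _ → id) split ⟩
      length (outsideImage ++ image)     ≡⟨ length-++ outsideImage ⟩
      length outsideImage + length image ≡⟨ cong (length outsideImage +_) (length-map pull (closedSets D)) ⟩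
      length outsideImage + rank D       ∎
      where
      open ≤-Reasoning
      split : ∀ {x} → x ∈ closedSets C → x ∈ outsideImage ++ image
      split {x} x∈ with ∈-image? x
      ... | yes x∈image = ∈-++⁺ʳ outsideImage x∈image
      ... | no x∉image  = ∈-++⁺ˡ (∈-filter⁺ outsideImage? x∈ x∉image)

  two-outside-image : 2 + rank D ≤ rank C →
                      ∃₂ λ x y → (Closed C x × x ∉ image) × (Closed C y × y ∉ image) ×
                                 ¬ x ⊆ y
  two-outside-image 2+D≤C
    with distinct-pair (Unique.filter⁺ outsideImage? (closedSets! {C = C}))
                       (+-cancelʳ-≤ (rank D) 2 _ (≤-trans 2+D≤C rank≤outsideImage+rank))
  ... | x , y , x∈ , y∈ , x≢y with x ⊆? y
  ...   | no x⊈y  = x , y , ∈-outsideImage⁻ x∈ , ∈-outsideImage⁻ y∈ , x⊈y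
  ...   | yes x⊆y =
    y , x , ∈-outsideImage⁻ y∈ , ∈-outsideImage⁻ x∈ , x≢y ∘ ⊆-antisym x⊆y

≼⇒rank≤ : ∀ {n m} {C : Code n} {D : Code m} → D ≼ C → rank D ≤ rank C
≼⇒rank≤ (_ , mor , sur) = SurjectiveMorphism.rank≤ mor sur

Iso⇒≼ : ∀ {n m} {C : Code n} {D : Code m} → Iso C D → C ≼ D
Iso⇒≼ (f , g , mor-f , mor-g , g∘f , _) =
  g , mor-g , λ c c∈ → f c , proj₁ mor-f c c∈ , g∘f c c∈

≺⇒rank< : ∀ {n m} {C : Code n} {D : Code m} → D ≺ C → rank D < rank C
≺⇒rank< {C = C} {D} ((_ , mor , sur) , ¬iso) with rank C ≤? rank D
... | yes C≤D = ⊥-elim (¬iso (SurjectiveMorphism.rank≤⇒Iso mor sur C≤D))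
... | no C≰D  = ≰⇒> C≰D

rank<⇒≺ : ∀ {n m} {C : Code n} {D : Code m} → D ≼ C → rank D < rank C → D ≺ C
rank<⇒≺ D≼C D<C = D≼C , λ iso → <⇒≱ D<C (≼⇒rank≤ (Iso⇒≼ iso))

module HatMorphism {n m : ℕ} {C : Code n} {D : Code m} {f : Subset n → Subset m}
                   (mor : IsMorphism C D f) (sur : IsSurjOn C D f) where
  open SurjectiveMorphism mor sur using (pull; pull-trunk; pull-Closed)

  push : Subset n → Subset m
  push h = ⋂ (map f (filter (h ⊆?_) C))

  ⊆-push⇔ : ∀ {σ h} → σ ⊆ push h ⇔ (∀ c → c ∈ C → h ⊆ c → σ ⊆ f c)
  ⊆-push⇔ {σ} {h} = mk⇔ lower greatest
    where
    lower : σ ⊆ push h → ∀ c → c ∈ C → h ⊆ c → σ ⊆ f c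
    lower σ⊆push c c∈ h⊆c =
      ⊆-trans σ⊆push (⋂-lowerBound (∈-map⁺ f (∈-filter⁺ (h ⊆?_) c∈ h⊆c)))

    greatest : (∀ c → c ∈ C → h ⊆ c → σ ⊆ f c) → σ ⊆ push h
    greatest σ⊆f = ⋂-greatest bound
      where
      bound : ∀ {p} → p ∈ map f (filter (h ⊆?_) C) → σ ⊆ p
      bound p∈ with ∈-map⁻ f p∈
      ... | c , c∈ , refl =
        let c∈C , h⊆c = ∈-filter⁻ (h ⊆?_) {xs = C} c∈ in σ⊆f c c∈C h⊆c

  push-lowerBound : ∀ {c h} → c ∈ C → h ⊆ c → push h ⊆ f c
  push-lowerBound c∈ h⊆c = to ⊆-push⇔ ⊆-refl _ c∈ h⊆c

  push-Closed : ∀ {h} → NonemptyTrunk C h → Closed D (push h)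
  push-Closed {h} (c , c∈ , h⊆c) =
    (f c , proj₁ mor c c∈ , push-lowerBound c∈ h⊆c) ,
    from ⊆-push⇔ λ c′ c′∈ h⊆c′ →
      to (closure-trunk D (push h) (f c′) (proj₁ mor c′ c′∈)) (push-lowerBound c′∈ h⊆c′)

  push∘pull : ∀ {z} → Closed D z → push (pull z) ≡ z
  push∘pull {z} kz@(ne , _) = ⊆-antisym
    (Closed-⊆ D kz (surjective-∀ sur {P = λ d → z ⊆ d → push (pull z) ⊆ d}
      λ c c∈ z⊆fc → push-lowerBound c∈ (to (pull-trunk ne c c∈) z⊆fc)))
    (from ⊆-push⇔ λ c c∈ → from (pull-trunk ne c c∈))

  push-sur : IsSurjOn (hat C) (hat D) push
  push-sur z z∈ = pull z , Closed⇒∈-hat (pull-Closed (proj₁ kz)) , push∘pull kz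
    where kz = ∈-hat⇒Closed z∈

  push-maps : ∀ h → h ∈ hat C → push h ∈ hat D
  push-maps h h∈ = Closed⇒∈-hat (push-Closed (proj₁ (∈-hat⇒Closed h∈)))

  push-trunks : ∀ σ → ProperTrunk (hat D) σ →
                ∃[ τ ] IsTrunkOf (hat C) (λ h → σ ⊆ push h) τ
  push-trunks σ ((z , z∈ , σ⊆z) , _) with ∈-hat⇒Closed z∈
  ... | (d , d∈ , z⊆d) , _ with preimage-trunk mor (d , d∈ , ⊆-trans σ⊆z z⊆d)
  ...   | τ , trunk = τ , λ h h∈ → mk⇔ (⊆push⇒⊆ h∈) ⊆⇒⊆push
    where
    ⊆push⇒⊆ : ∀ {h} → h ∈ hat C → σ ⊆ push h → τ ⊆ h
    ⊆push⇒⊆ h∈ σ⊆push = Closed-⊆ C (∈-hat⇒Closed h∈)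
      λ c c∈ h⊆c → to (trunk c c∈) (to ⊆-push⇔ σ⊆push c c∈ h⊆c)

    ⊆⇒⊆push : ∀ {h} → τ ⊆ h → σ ⊆ push h
    ⊆⇒⊆push τ⊆h = from ⊆-push⇔ λ c c∈ h⊆c → from (trunk c c∈) (⊆-trans τ⊆h h⊆c)

hat-≼ : ∀ {n m} {C : Code n} {D : Code m} → D ≼ C → hat D ≼ hat C
hat-≼ (_ , mor , sur) = push , trunks⇒IsMorphism push-maps push-sur push-trunks , push-sur
  where open HatMorphism mor sur

module Split {n m : ℕ} {C : Code n} {D : Code m} {f : Subset n → Subset m}
             (mor : IsMorphism C D f) (sur : IsSurjOn C D f) (x : Subset n) where
  open SurjectiveMorphism mor sur using (image; ∈-image⁺; ∅∈image)

  g : Subset n → Subset (suc m)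
  g c = does (x ⊆? c) ∷ f c

  E : Code (suc m)
  E = map g C

  g-outside : ∀ {σ} c → (outside ∷ σ ⊆ g c) ⇔ (σ ⊆ f c)
  g-outside c = ⇔-sym out⊆-⇔

  g-inside : ∀ {σ} c → (inside ∷ σ ⊆ g c) ⇔ (x ⊆ c × σ ⊆ f c)
  g-inside {σ} c with x ⊆? c
  ... | yes x⊆c = mk⇔ split (in⊆in ∘ proj₂)
    where
    split : inside ∷ σ ⊆ inside ∷ f c → x ⊆ c × σ ⊆ f c
    split σ⊆ = x⊆c , drop-∷-⊆ σ⊆
  ... | no x⊈c  = mk⇔ (λ σ⊆ → contradiction (σ⊆ here) λ ()) (⊥-elim ∘ x⊈c ∘ proj₁)

  inside∅-trunk : IsTrunkOf C (λ c → inside ∷ ∅ ⊆ g c) x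
  inside∅-trunk c _ =
    mk⇔ (proj₁ ∘ to (g-inside c)) λ x⊆c → from (g-inside c) (x⊆c , ⊆-min (f c))

  tail-maps : ∀ e → e ∈ E → tail e ∈ D
  tail-maps e e∈ with ∈-map⁻ g e∈
  ... | c , c∈ , refl = proj₁ mor c c∈

  tail-sur : IsSurjOn E D tail
  tail-sur d d∈ with sur d d∈
  ... | c , c∈ , refl = g c , ∈-map⁺ g c∈ , refl

  tail-IsMorphism : IsMorphism E D tail
  tail-IsMorphism =
    trunks⇒IsMorphism tail-maps tail-sur λ σ _ → outside ∷ σ , λ { (_ ∷ _) _ → out⊆-⇔ }

  g-sur : IsSurjOn C E g
  g-sur e e∈ = let c , c∈ , e≡gc = ∈-map⁻ g e∈ in c , c∈ , sym e≡gc

  g-IsMorphism : IsMorphism C E g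
  g-IsMorphism = trunks⇒IsMorphism (λ _ → ∈-map⁺ g) g-sur trunks
    where
    trunks : ∀ σ → ProperTrunk E σ → ∃[ τ ] IsTrunkOf C (λ c → σ ⊆ g c) τ
    trunks (b ∷ σ) ((_ ∷ e , e∈ , bσ⊆e) , _)
      with preimage-trunk mor (e , tail-maps _ e∈ , drop-∷-⊆ bσ⊆e)
    ... | τ , trunk with b
    ...   | outside = τ , λ c c∈ → ⇔-trans (g-outside c) (trunk c c∈)
    ...   | inside  =
      x ∪ τ , λ c c∈ → ⇔-trans (g-inside c) (∪-trunk C (λ _ _ → ⇔-id _) trunk c c∈)

  E-IsCode : IsCode C → IsCode D → x ∉ image → IsCode E
  E-IsCode ∅∈C ∅∈D x∉ = subst (_∈ E) g∅≡∅ (∈-map⁺ g ∅∈C)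
    where
    x⊈∅ : ¬ x ⊆ ∅
    x⊈∅ x⊆∅ = x∉ (subst (_∈ image) (⊆-antisym (⊆-min x) x⊆∅) (∅∈image ∅∈C ∅∈D))

    g∅≡∅ : g ∅ ≡ ∅
    g∅≡∅ = cong₂ _∷_ (dec-false (x ⊆? ∅) x⊈∅) (morphism-∅≡∅ ∅∈C ∅∈D mor)

  module T = SurjectiveMorphism tail-IsMorphism tail-sur
  module G = SurjectiveMorphism g-IsMorphism g-sur

  D≺E : Closed C x → x ∉ image → D ≺ E
  D≺E kx@((c , c∈ , x⊆c) , _) x∉ =
    rank<⇒≺ (tail , tail-IsMorphism , tail-sur) (T.rank< (closure-Closed E ne) z∉)
    where
    ne : NonemptyTrunk E (inside ∷ ∅)
    ne = g c , ∈-map⁺ g c∈ , from (g-inside c) (x⊆c , ⊆-min _)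

    z∉ : closure E (inside ∷ ∅) ∉ T.image
    z∉ z∈ with T.∈-image⁻ z∈
    ... | w , kw , trunk = x∉ (∈-image⁺ kx (proj₁ kw) λ c c∈ → begin
      w ⊆ f c                      ∼⟨ trunk (g c) (∈-map⁺ g c∈) ⟩
      closure E (inside ∷ ∅) ⊆ g c ∼⟨ ⇔-sym (closure-trunk E _ (g c) (∈-map⁺ g c∈)) ⟩
      inside ∷ ∅ ⊆ g c             ∼⟨ inside∅-trunk c c∈ ⟩
      x ⊆ c                        ∎)
      where open EquationalReasoning {k = equivalence}

  E≺C : ∀ {y} → Closed C y → y ∉ image → ¬ x ⊆ y → E ≺ C
  E≺C {y} ky y∉ x⊈y = rank<⇒≺ (g , g-IsMorphism , g-sur) (G.rank< ky y∉G)
    where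
    y∉G : y ∉ G.image
    y∉G y∈ with G.∈-image⁻ y∈
    ... | outside ∷ w , ((_ ∷ e , e∈ , w⊆e) , _) , trunk =
      y∉ (∈-image⁺ ky (e , tail-maps _ e∈ , drop-∷-⊆ w⊆e)
           λ c c∈ → ⇔-trans (⇔-sym (g-outside c)) (trunk c c∈))
    ... | inside ∷ w , _ , trunk =
      x⊈y (Closed-⊆ C ky λ c c∈ y⊆c → proj₁ (to (g-inside c) (from (trunk c c∈) y⊆c)))

covers⇒rank≤ : ∀ {n m} {C : Code n} {D : Code m} → IsCode C → IsCode D →
               Covers C D → rank C ≤ suc (rank D)
covers⇒rank≤ {m = m} {C} {D} ∅∈C ∅∈D (((f , mor , sur) , _) , no-middle)
  with rank C ≤? suc (rank D)
... | yes C≤1+D = C≤1+D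
... | no C≰1+D with SurjectiveMorphism.two-outside-image mor sur (≰⇒> C≰1+D)
...   | x , y , (kx , x∉) , (ky , y∉) , x⊈y =
  ⊥-elim (no-middle (suc m , E , E-IsCode ∅∈C ∅∈D x∉ , D≺E kx x∉ , E≺C ky y∉ x⊈y))
  where open Split mor sur x

corollary16 : ∀ {n m} (C : Code n) (D : Code m) → IsCode C → IsCode D →
                Covers C D → Covers (hat C) (hat D)
corollary16 C D ∅∈C ∅∈D C⋗D@(D≺C@(D≼C , _) , _) =
  rank<⇒≺ (hat-≼ D≼C) hatD<hatC , no-middle
  where
  open ≤-Reasoning

  C≤1+D : rank C ≤ suc (rank D)
  C≤1+D = covers⇒rank≤ ∅∈C ∅∈D C⋗D

  hatD<hatC : rank (hat D) < rank (hat C)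
  hatD<hatC = begin-strict
    rank (hat D) ≡⟨ rank-hat D ⟩
    rank D       <⟨ ≺⇒rank< D≺C ⟩
    rank C       ≡⟨ rank-hat C ⟨
    rank (hat C) ∎

  no-middle : ¬ (∃[ k ] ∃[ E ] (IsCode {k} E × hat D ≺ E × E ≺ hat C))
  no-middle (_ , E , _ , hatD≺E , E≺hatC) = <⇒≱ 1+D<C C≤1+D
    where
    1+D<C : suc (rank D) < rank C
    1+D<C = begin-strict
      suc (rank D)       ≡⟨ cong suc (rank-hat D) ⟨
      suc (rank (hat D)) ≤⟨ ≺⇒rank< hatD≺E ⟩
      rank E             <⟨ ≺⇒rank< E≺hatC ⟩
      rank (hat C)       ≡⟨ rank-hat C ⟩
      rank C             ∎
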